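{- Let $\alpha\in(0,1)$ be irrational, $\alpha=[0;a_1,a_2,\dots]$, and let $n\ge1$ with $a_n=a_{n+1}=a_{n+2}=1$. Then $2q_n$ and $2q_{n+1}$ are two successive elements of the sequence $\mathfrak{Q}$.
   Context: $p_n/q_n=[0;a_1,\dots,a_n]$ ($n\ge0$, lowest terms, $q_n>0$) are the convergents of $\alpha$, with $q_{ -1}=0$, $q_0=1$, $q_n=a_nq_{n-1}+q_{n-2}$. For $t\ge1$, $\psi^{[2]}_\alpha(t)=\min\{|q\alpha-p|: p,q\in\mathbb{Z},\ 1\le q\le t,\ (p,q)\ne(p_n,q_n)\ \forall n\ge0\}$; this function is piecewise constant with integer points of discontinuity. $\mathfrak{Q}:\ 1=\mathfrak{q}_1<\mathfrak{q}_2<\dots$ is the increasing sequence consisting of $1$ and all points of discontinuity of $\psi^{[2]}_\alpha$. -}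

module Defs where

open import Data.Nat as ℕ using (ℕ; zero; suc)
open import Data.Integer as ℤ using (ℤ; +_; -_; _-_)
open import Data.Product using (Σ; ∃; ∃-syntax; _×_; _,_; proj₁; proj₂)
open import Data.Sum using (_⊎_)
open import Relation.Nullary using (¬_)
open import Relation.Binary.PropositionalEquality using (_≡_)

-- An irrational α ∈ (0,1) is represented by its (infinite) continued fraction
-- α = [0; a 1, a 2, ...]  with  a i ≥ 1 for i ≥ 1  (the value  a 0  is ignored).
PartialQuotients : (ℕ → ℕ) → Set
PartialQuotients a = ∀ i → 1 ℕ.≤ i → 1 ℕ.≤ a i

-- conv a n = (p_n , q_n , p_{n-1} , q_{n-1}),  with p_{-1}=1, q_{-1}=0, p_0=0, q_0=1.
conv : (ℕ → ℕ) → ℕ → ℕ × ℕ × ℕ × ℕ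
conv a zero = 0 , 1 , 1 , 0
conv a (suc n) with conv a n
... | p , q , p' , q' = a (suc n) ℕ.* p ℕ.+ p' , a (suc n) ℕ.* q ℕ.+ q' , p , q

p : (ℕ → ℕ) → ℕ → ℕ
p a n = proj₁ (conv a n)

q : (ℕ → ℕ) → ℕ → ℕ
q a n = proj₁ (proj₂ (conv a n))

-- "A·α < B" for integers A, B: α lies strictly between consecutive convergents
-- p_n/q_n and p_{n+1}/q_{n+1}, which converge to α; hence A·α < B iff for some n
-- the linear form A·x − B is negative at both of them.
LinLt : (ℕ → ℕ) → ℤ → ℤ → Set
LinLt a A B = ∃[ n ] ((A ℤ.* + p a n ℤ.< B ℤ.* + q a n)
                    × (A ℤ.* + p a (suc n) ℤ.< B ℤ.* + q a (suc n)))

-- A linear form  Q·α − P  is represented by the pair (Q , P).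
Form : Set
Form = ℤ × ℤ

neg : Form → Form
neg (Q , P) = - Q , - P

FLt : (ℕ → ℕ) → Form → Form → Set
FLt a (Q , P) (Q' , P') = LinLt a (Q - Q') (P - P')

AbsLt : (ℕ → ℕ) → Form → Form → Set
AbsLt a x y = (FLt a x y × FLt a (neg x) y) ⊎ (FLt a x (neg y) × FLt a (neg x) (neg y))

form : ℤ → ℕ → Form
form P Q = + Q , P

IsConvergent : (ℕ → ℕ) → ℤ → ℕ → Set
IsConvergent a P Q = ∃[ n ] (P ≡ + p a n × Q ≡ q a n)

-- (P , Q) is admissible in the definition of ψ^[2](t) for t a natural number
Admissible : (ℕ → ℕ) → ℕ → ℤ → ℕ → Set
Admissible a t P Q = (1 ℕ.≤ Q × Q ℕ.≤ t) × ¬ IsConvergent a P Q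

Minimizer : (ℕ → ℕ) → ℕ → ℤ → ℕ → Set
Minimizer a t P Q = Admissible a t P Q
  × (∀ P' Q' → Admissible a t P' Q' → ¬ AbsLt a (form P' Q') (form P Q))

-- ψ^[2] is constant on [k, k+1); it is discontinuous at the integer k ≥ 2
-- iff ψ^[2](k) ≠ ψ^[2](k−1).
Discontinuity : (ℕ → ℕ) → ℕ → Set
Discontinuity a k = 2 ℕ.≤ k × ∃[ P ] ∃[ Q ] ∃[ P' ] ∃[ Q' ]
  (Minimizer a k P Q × Minimizer a (k ℕ.∸ 1) P' Q'
   × (AbsLt a (form P Q) (form P' Q') ⊎ AbsLt a (form P' Q') (form P Q)))

InQ : (ℕ → ℕ) → ℕ → Set
InQ a k = k ≡ 1 ⊎ Discontinuity a k

Successive : (ℕ → ℕ) → ℕ → ℕ → Set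
Successive a m m' = InQ a m × InQ a m' × m ℕ.< m'
  × (∀ k → m ℕ.< k → k ℕ.< m' → ¬ InQ a k)

{-# OPTIONS --safe #-}
module Submission where

-- Write e k for the form q_k α − p_k and δ k = |e k| = (−1)^k e k. Consecutive e m, e (m + 1) form a
-- unimodular basis of the forms Qα − P. If a_n = a_{n+1} = 1, the bound 1 ≤ Q ≤ 2 q_{n+1} leaves, in the
-- basis e (n + 1), e (n + 2), only finitely many coordinate pairs whose form is not larger than 2 e n in
-- absolute value: the convergents, 2 e n itself, and points with Q ≥ 2 q_{n+1}. So 2 e n is the unique
-- minimiser of ψ^[2](t) for 2 q_n ≤ t < 2 q_{n+1}, while the minima at t = 2 q_n − 1 and t = 2 q_{n+1}
-- are larger and smaller respectively: they are 2 δ (n − 1) and 2 δ (n + 1) when n ≥ 2, and are found by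
-- hand when n = 1. Real numbers never appear: Qα − P > 0 iff Q p_N − P q_N > 0 for all large N.

open import Defs
open import Data.Nat as ℕ using (ℕ; zero; suc; z≤n; s≤s)
import Data.Nat.Properties as ℕP
import Data.Nat.Tactic.RingSolver as ℕ-Solver
open import Data.Integer as ℤ using (ℤ; +_; -[1+_]; +[1+_]; 0ℤ; 1ℤ; -1ℤ; -_; _-_)
import Data.Integer.Properties as ℤP
open import Data.Integer.Tactic.RingSolver using (solve-∀)
open import Data.Product using (∃; ∃-syntax; _×_; _,_; proj₁; proj₂)
open import Data.Sum using (_⊎_; inj₁; inj₂; [_,_]′)
open import Data.Empty using (⊥; ⊥-elim)
open import Relation.Nullary using (¬_)
open import Relation.Binary.PropositionalEquality

module Integers where
  open import Data.Integer using (_+_; _*_; _<_)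

  i<j⇒0<j-i : ∀ {i j} → i < j → 0ℤ < j - i
  i<j⇒0<j-i {i} {j} i<j = subst (_< j - i) (ℤP.+-inverseʳ i) (ℤP.+-monoˡ-< (- i) i<j)

  0<j-i⇒i<j : ∀ {i j} → 0ℤ < j - i → i < j
  0<j-i⇒i<j {i} {j} 0<j-i = subst₂ _<_ (ℤP.+-identityˡ i) (j-i+i≡j i j) (ℤP.+-monoˡ-< i 0<j-i)
    where
    j-i+i≡j : ∀ i j → j - i + i ≡ j
    j-i+i≡j = solve-∀

  pos-*-+ : ∀ m x y → + (m ℕ.* x ℕ.+ y) ≡ + m * + x + + y
  pos-*-+ m x y = trans (ℤP.pos-+ (m ℕ.* x) y) (cong (_+ + y) (ℤP.pos-* m x))

  positive-part negative-part : ℤ → ℕ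
  positive-part (+ n)    = n
  positive-part -[1+ n ] = 0
  negative-part (+ n)    = 0
  negative-part -[1+ n ] = suc n

  -- Q = X x + Y w over ℤ, with both sides moved so that no subtraction occurs
  coefficient-parts : ∀ {Q x w} X Y → + Q ≡ X * + x + Y * + w →
    Q ℕ.+ (negative-part X ℕ.* x ℕ.+ negative-part Y ℕ.* w) ≡ positive-part X ℕ.* x ℕ.+ positive-part Y ℕ.* w
  coefficient-parts {Q} {x} {w} X Y eq = ℤP.+-injective (begin
    + (Q ℕ.+ (X⁻ ℕ.* x ℕ.+ Y⁻ ℕ.* w))        ≡⟨ cong (λ v → + Q + v) (pos-*+* X⁻ x Y⁻ w) ⟩
    + Q + (+ X⁻ * + x + + Y⁻ * + w)          ≡⟨ cong (_+ (+ X⁻ * + x + + Y⁻ * + w)) eq ⟩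
    X * + x + Y * + w + (+ X⁻ * + x + + Y⁻ * + w)
      ≡⟨ cong₂ (λ X Y → X * + x + Y * + w + (+ X⁻ * + x + + Y⁻ * + w)) (parts X) (parts Y) ⟩
    (+ X⁺ - + X⁻) * + x + (+ Y⁺ - + Y⁻) * + w + (+ X⁻ * + x + + Y⁻ * + w)
      ≡⟨ ring (+ X⁺) (+ X⁻) (+ Y⁺) (+ Y⁻) (+ x) (+ w) ⟩
    + X⁺ * + x + + Y⁺ * + w                  ≡⟨ sym (pos-*+* X⁺ x Y⁺ w) ⟩
    + (X⁺ ℕ.* x ℕ.+ Y⁺ ℕ.* w)              ∎)
    where
    open ≡-Reasoning
    X⁺ = positive-part X
    X⁻ = negative-part X
    Y⁺ = positive-part Y
    Y⁻ = negative-part Y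
    pos-*+* : ∀ m x n w → + (m ℕ.* x ℕ.+ n ℕ.* w) ≡ + m * + x + + n * + w
    pos-*+* m x n w = trans (pos-*-+ m x (n ℕ.* w)) (cong (λ v → + m * + x + v) (ℤP.pos-* n w))
    parts : ∀ X → X ≡ + positive-part X - + negative-part X
    parts (+ n)    = sym (ℤP.+-identityʳ (+ n))
    parts -[1+ n ] = refl
    ring : ∀ A B C D x w → (A - B) * x + (C - D) * w + (B * x + D * w) ≡ A * x + C * w
    ring = solve-∀

open Integers

module FormAlgebra where
  open import Data.Integer using (_+_; _*_)

  infixl 6 _⊕_ _⊖_
  infixr 7 _·_

  _⊕_ _⊖_ : Form → Form → Form
  (Q , P) ⊕ (Q' , P') = Q + Q' , P + P'
  (Q , P) ⊖ (Q' , P') = Q - Q' , P - P'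

  _·_ : ℤ → Form → Form
  c · (Q , P) = c * Q , c * P

  𝟎 : Form
  𝟎 = 0ℤ , 0ℤ

  ⊖-self : ∀ x → x ⊖ x ≡ 𝟎
  ⊖-self (Q , P) = cong₂ _,_ (ℤP.+-inverseʳ Q) (ℤP.+-inverseʳ P)

  ⊖-⊕-⊖ : ∀ x y z → (z ⊖ y) ⊕ (y ⊖ x) ≡ z ⊖ x
  ⊖-⊕-⊖ (Q , P) (Q' , P') (Q'' , P'') = cong₂ _,_ (ident Q Q' Q'') (ident P P' P'')
    where
    ident : ∀ i j k → (k - j) + (j - i) ≡ k - i
    ident = solve-∀

  ⊖-neg : ∀ x y → y ⊖ neg x ≡ (y ⊖ x) ⊕ (x ⊕ x)
  ⊖-neg (Q , P) (Q' , P') = cong₂ _,_ (ident Q Q') (ident P P')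
    where
    ident : ∀ i j → j - - i ≡ (j - i) + (i + i)
    ident = solve-∀

  ·-⊖-· : ∀ c x y → c · x ⊖ c · y ≡ c · (x ⊖ y)
  ·-⊖-· c (Q , P) (Q' , P') = cong₂ _,_ (ident c Q Q') (ident c P P')
    where
    ident : ∀ c i j → c * i - c * j ≡ c * (i - j)
    ident = solve-∀

  0·-⊕ : ∀ x y → + 0 · x ⊕ y ≡ y
  0·-⊕ (Q , P) (Q' , P') = cong₂ _,_ (ℤP.+-identityˡ Q') (ℤP.+-identityˡ P')

  neg-involutive : ∀ x → neg (neg x) ≡ x
  neg-involutive (Q , P) = cong₂ _,_ (ℤP.neg-involutive Q) (ℤP.neg-involutive P)

  infix 4 _≡±_

  _≡±_ : Form → Form → Set
  x ≡± y = x ≡ y ⊎ x ≡ neg y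

  ≡±-trans : ∀ {x y z} → x ≡± y → y ≡± z → x ≡± z
  ≡±-trans (inj₁ refl) y≡±z         = y≡±z
  ≡±-trans (inj₂ refl) (inj₁ refl)  = inj₂ refl
  ≡±-trans (inj₂ refl) (inj₂ refl)  = inj₁ (neg-involutive _)

  ·-≡± : ∀ c {x y} → x ≡± y → c · x ≡± c · y
  ·-≡± c (inj₁ refl) = inj₁ refl
  ·-≡± c {y = Q , P} (inj₂ refl) =
    inj₂ (cong₂ _,_ (sym (ℤP.neg-distribʳ-* c Q)) (sym (ℤP.neg-distribʳ-* c P)))

  ≡±-unit : ∀ {c} → c ≡ 1ℤ ⊎ c ≡ -1ℤ → ∀ x → x ≡± c · x
  ≡±-unit (inj₁ refl) (Q , P) = inj₁ (cong₂ _,_ (sym (ℤP.*-identityˡ Q)) (sym (ℤP.*-identityˡ P)))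
  ≡±-unit (inj₂ refl) (Q , P) = inj₂ (cong₂ _,_ (ident Q) (ident P))
    where
    ident : ∀ i → i ≡ - (-1ℤ * i)
    ident = solve-∀

  combination-≡± : ∀ {c} → c ≡ 1ℤ ⊎ c ≡ -1ℤ → ∀ X Y u w →
    X · u ⊕ Y · w ≡± X · (c · u) ⊕ (- Y) · ((-1ℤ * c) · w)
  combination-≡± (inj₁ refl) X Y (Q , P) (Q' , P') = inj₁ (cong₂ _,_ (ident X Y Q Q') (ident X Y P P'))
    where
    ident : ∀ X Y i j → X * i + Y * j ≡ X * (1ℤ * i) + (- Y) * (-1ℤ * 1ℤ * j)
    ident = solve-∀
  combination-≡± (inj₂ refl) X Y (Q , P) (Q' , P') = inj₂ (cong₂ _,_ (ident X Y Q Q') (ident X Y P P'))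
    where
    ident : ∀ X Y i j → X * i + Y * j ≡ - (X * (-1ℤ * i) + (- Y) * (-1ℤ * -1ℤ * j))
    ident = solve-∀

open FormAlgebra

module Positivity (a : ℕ → ℕ) (pq : PartialQuotients a) where
  open import Data.Integer using (_+_; _*_; _<_; _≤_)

  eval : ℕ → Form → ℤ
  eval N (Q , P) = Q * + p a N - P * + q a N

  eval-rec : ∀ N x → eval (suc (suc N)) x ≡ + a (suc (suc N)) * eval (suc N) x + eval N x
  eval-rec N (Q , P) = begin
    Q * + (A ℕ.* p₁ ℕ.+ p₀) - P * + (A ℕ.* q₁ ℕ.+ q₀)
      ≡⟨ cong₂ (λ u v → Q * u - P * v) (pos-*-+ A p₁ p₀) (pos-*-+ A q₁ q₀) ⟩
    Q * (+ A * + p₁ + + p₀) - P * (+ A * + q₁ + + q₀)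
      ≡⟨ ident Q P (+ A) (+ p₁) (+ p₀) (+ q₁) (+ q₀) ⟩
    + A * (Q * + p₁ - P * + q₁) + (Q * + p₀ - P * + q₀) ∎
    where
    open ≡-Reasoning
    A = a (suc (suc N))
    p₁ = p a (suc N)
    p₀ = p a N
    q₁ = q a (suc N)
    q₀ = q a N
    ident : ∀ Q P A p₁ p₀ q₁ q₀ →
      Q * (A * p₁ + p₀) - P * (A * q₁ + q₀) ≡ A * (Q * p₁ - P * q₁) + (Q * p₀ - P * q₀)
    ident = solve-∀

  eval-⊕ : ∀ M x y → eval M (x ⊕ y) ≡ eval M x + eval M y
  eval-⊕ M (Q , P) (Q' , P') = ident Q P Q' P' (+ p a M) (+ q a M)
    where
    ident : ∀ Q P Q' P' u v → (Q + Q') * u - (P + P') * v ≡ (Q * u - P * v) + (Q' * u - P' * v)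
    ident = solve-∀

  eval-· : ∀ M c x → eval M (c · x) ≡ c * eval M x
  eval-· M c (Q , P) = ident c Q P (+ p a M) (+ q a M)
    where
    ident : ∀ c Q P u v → (c * Q) * u - (c * P) * v ≡ c * (Q * u - P * v)
    ident = solve-∀

  -- Qα − P > 0. eval N x is q_N times the form at α = p_N / q_N, and the convergents tend to α.
  record Positive (x : Form) : Set where
    constructor eventually
    field
      threshold : ℕ
      beyond    : ∀ {M} → threshold ℕ.≤ M → 0ℤ < eval M x

  positive-⊕ : ∀ {x y} → Positive x → Positive y → Positive (x ⊕ y)
  positive-⊕ {x} {y} (eventually N hx) (eventually N' hy) = eventually (N ℕ.⊔ N') λ {M} le →
    subst (0ℤ <_) (sym (eval-⊕ M x y))
      (ℤP.+-mono-< (hx (ℕP.≤-trans (ℕP.m≤m⊔n N N') le)) (hy (ℕP.≤-trans (ℕP.m≤n⊔m N N') le)))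

  0<-scale : ∀ k {v} → 0ℤ < v → 0ℤ < +[1+ k ] * v
  0<-scale k {v} 0<v = subst (_< +[1+ k ] * v) (ℤP.*-zeroʳ +[1+ k ]) (ℤP.*-monoˡ-<-pos +[1+ k ] 0<v)

  positive-· : ∀ {x} k → Positive x → Positive (+[1+ k ] · x)
  positive-· {x} k (eventually N h) = eventually N λ {M} le →
    subst (0ℤ <_) (sym (eval-· M +[1+ k ] x)) (0<-scale k (h le))

  positive-multiple-⊕ : ∀ {x y} n → Positive x → Positive y → Positive (+ n · x ⊕ y)
  positive-multiple-⊕ {x} {y} zero    _  py = subst Positive (sym (0·-⊕ x y)) py
  positive-multiple-⊕         (suc n) px py = positive-⊕ (positive-· n px) py

  ¬positive-𝟎 : ¬ Positive 𝟎
  ¬positive-𝟎 (eventually N h) = ℤP.<-irrefl refl (h ℕP.≤-refl)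

  -- eval (N + 2) = a_{N+2} eval (N + 1) + eval N with a_{N+2} ≥ 1 keeps the values positive
  positive-from : ∀ x N → 0ℤ ≤ eval N x → 0ℤ < eval (suc N) x → Positive x
  positive-from x N h₀ h₁ = eventually (suc N) λ {M} le →
    subst (λ M → 0ℤ < eval M x) (index le) (proj₂ (stays-positive (M ℕ.∸ suc N)))
    where
    step : ∀ {u v} A → 1 ℕ.≤ A → 0ℤ ≤ u → 0ℤ < v → 0ℤ < + A * v + u
    step (suc A) _ 0≤u 0<v = ℤP.+-mono-<-≤ (0<-scale A 0<v) 0≤u
    stays-positive : ∀ k → 0ℤ ≤ eval (k ℕ.+ N) x × 0ℤ < eval (suc (k ℕ.+ N)) x
    stays-positive zero    = h₀ , h₁
    stays-positive (suc k) with stays-positive k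
    ... | u , v = ℤP.<⇒≤ v , subst (0ℤ <_) (sym (eval-rec (k ℕ.+ N) x)) (step _ (pq _ (s≤s z≤n)) u v)
    index : ∀ {M} → suc N ℕ.≤ M → suc (M ℕ.∸ suc N ℕ.+ N) ≡ M
    index {M} le = trans (sym (ℕP.+-suc (M ℕ.∸ suc N) N)) (ℕP.m∸n+n≡m le)

  <⇒positive : ∀ x y → FLt a x y → Positive (y ⊖ x)
  <⇒positive (Q , P) (Q' , P') (N , lt₀ , lt₁) =
    positive-from ((Q' , P') ⊖ (Q , P)) N (ℤP.<⇒≤ (at N lt₀)) (at (suc N) lt₁)
    where
    at : ∀ M → (Q - Q') * + p a M < (P - P') * + q a M → 0ℤ < eval M ((Q' , P') ⊖ (Q , P))
    at M lt = subst (0ℤ <_) (ident Q P Q' P' (+ p a M) (+ q a M)) (i<j⇒0<j-i lt)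
      where
      ident : ∀ Q P Q' P' u v → (P - P') * v - (Q - Q') * u ≡ (Q' - Q) * u - (P' - P) * v
      ident = solve-∀

  positive⇒< : ∀ x y → Positive (y ⊖ x) → FLt a x y
  positive⇒< (Q , P) (Q' , P') (eventually N h) =
    N , at N (h ℕP.≤-refl) , at (suc N) (h (ℕP.n≤1+n N))
    where
    at : ∀ M → 0ℤ < eval M ((Q' , P') ⊖ (Q , P)) → (Q - Q') * + p a M < (P - P') * + q a M
    at M 0<e = 0<j-i⇒i<j (subst (0ℤ <_) (ident Q P Q' P' (+ p a M) (+ q a M)) 0<e)
      where
      ident : ∀ Q P Q' P' u v → (Q' - Q) * u - (P' - P) * v ≡ (P - P') * v - (Q - Q') * u
      ident = solve-∀

  <-trans : ∀ x y z → FLt a x y → FLt a y z → FLt a x z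
  <-trans x y z x<y y<z =
    positive⇒< x z (subst Positive (⊖-⊕-⊖ x y z) (positive-⊕ (<⇒positive y z y<z) (<⇒positive x y x<y)))

  <-irrefl : ∀ x → ¬ FLt a x x
  <-irrefl x x<x = ¬positive-𝟎 (subst Positive (⊖-self x) (<⇒positive x x x<x))

  absLt-trans : ∀ {x y z} → AbsLt a x y → AbsLt a y z → AbsLt a x z
  absLt-trans {x} {y} {z} (inj₁ (x<y , -x<y)) (inj₁ (y<z , -y<z)) =
    inj₁ (<-trans x y z x<y y<z , <-trans (neg x) y z -x<y y<z)
  absLt-trans {x} {y} {z} (inj₁ (x<y , -x<y)) (inj₂ (y<-z , -y<-z)) =
    inj₂ (<-trans x y (neg z) x<y y<-z , <-trans (neg x) y (neg z) -x<y y<-z)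
  absLt-trans {x} {y} {z} (inj₂ (x<-y , -x<-y)) (inj₁ (y<z , -y<z)) =
    inj₁ (<-trans x (neg y) z x<-y -y<z , <-trans (neg x) (neg y) z -x<-y -y<z)
  absLt-trans {x} {y} {z} (inj₂ (x<-y , -x<-y)) (inj₂ (y<-z , -y<-z)) =
    inj₂ (<-trans x (neg y) (neg z) x<-y -y<-z , <-trans (neg x) (neg y) (neg z) -x<-y -y<-z)

  absLt-irrefl : ∀ {x} → ¬ AbsLt a x x
  absLt-irrefl {x} (inj₁ (x<x , _))   = <-irrefl x x<x
  absLt-irrefl {x} (inj₂ (_ , -x<-x)) = <-irrefl (neg x) -x<-x

  absLt-asym : ∀ {x y} → AbsLt a x y → ¬ AbsLt a y x
  absLt-asym {x} {y} x<y y<x = absLt-irrefl {x} (absLt-trans {x} {y} {x} x<y y<x)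

  absLt-intro : ∀ {x y} → Positive x → Positive (y ⊖ x) → AbsLt a x y
  absLt-intro {x} {y} 0<x x<y = inj₁ (positive⇒< x y x<y ,
    positive⇒< (neg x) y (subst Positive (sym (⊖-neg x y)) (positive-⊕ x<y (positive-⊕ 0<x 0<x))))

  absLt-negˡ : ∀ {x y} → AbsLt a x y → AbsLt a (neg x) y
  absLt-negˡ {x} {y} (inj₁ (x<y , -x<y))   = inj₁ (-x<y , subst (λ u → FLt a u y) (sym (neg-involutive x)) x<y)
  absLt-negˡ {x} {y} (inj₂ (x<-y , -x<-y)) =
    inj₂ (-x<-y , subst (λ u → FLt a u (neg y)) (sym (neg-involutive x)) x<-y)

  absLt-negʳ : ∀ {x y} → AbsLt a x y → AbsLt a x (neg y)
  absLt-negʳ {x} {y} (inj₁ (x<y , -x<y))   =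
    inj₂ (subst (FLt a x) (sym (neg-involutive y)) x<y , subst (FLt a (neg x)) (sym (neg-involutive y)) -x<y)
  absLt-negʳ (inj₂ (x<-y , -x<-y)) = inj₁ (x<-y , -x<-y)

  absLt-resp-≡± : ∀ {x x' y y'} → x ≡± x' → y ≡± y' → AbsLt a x' y' → AbsLt a x y
  absLt-resp-≡± (inj₁ refl) (inj₁ refl) lt = lt
  absLt-resp-≡± {x' = x'} {y' = y'} (inj₁ refl) (inj₂ refl) lt = absLt-negʳ {x'} {y'} lt
  absLt-resp-≡± {x' = x'} {y' = y'} (inj₂ refl) (inj₁ refl) lt = absLt-negˡ {x'} {y'} lt
  absLt-resp-≡± {x' = x'} {y' = y'} (inj₂ refl) (inj₂ refl) lt =
    absLt-negˡ {x'} {neg y'} (absLt-negʳ {x'} {y'} lt)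

  module _ (f g : Form) (0<g : Positive g) (g<f : Positive (f ⊖ g)) where
    private
      0<f : Positive f
      0<f = subst Positive (ident f g) (positive-⊕ g<f 0<g)
        where
        ident : ∀ x y → (x ⊖ y) ⊕ y ≡ x
        ident (Q , P) (Q' , P') = cong₂ _,_ (ring Q Q') (ring P P')
          where
          ring : ∀ u v → (u - v) + v ≡ u
          ring = solve-∀

      0<2f+2g : Positive (+ 2 · f ⊕ + 2 · g)
      0<2f+2g = positive-⊕ (positive-· 1 0<f) (positive-· 1 0<g)

    absLt-twice-sum₁ : ∀ i k → AbsLt a (+ 2 · f ⊕ + 2 · g) (+ (3 ℕ.+ i) · f ⊕ + (1 ℕ.+ k) · g)
    absLt-twice-sum₁ i k = absLt-intro 0<2f+2g (subst Positive (sym (ident (+ i) (+ k) f g))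
      (positive-multiple-⊕ i 0<f (positive-multiple-⊕ k 0<g g<f)))
      where
      ident : ∀ I K x y → ((+ 3 + I) · x ⊕ (+ 1 + K) · y) ⊖ (+ 2 · x ⊕ + 2 · y) ≡ I · x ⊕ (K · y ⊕ (x ⊖ y))
      ident I K (Q , P) (Q' , P') = cong₂ _,_ (ring I K Q Q') (ring I K P P')
        where
        ring : ∀ I K u v →
          ((+ 3 + I) * u + (+ 1 + K) * v) - (+ 2 * u + + 2 * v) ≡ I * u + (K * v + (u - v))
        ring = solve-∀

    absLt-twice-sum₂ : ∀ k → AbsLt a (+ 2 · f ⊕ + 2 · g) (+ 2 · f ⊕ + (3 ℕ.+ k) · g)
    absLt-twice-sum₂ k = absLt-intro 0<2f+2g
      (subst Positive (sym (ident (+ k) f g)) (positive-multiple-⊕ k 0<g 0<g))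
      where
      ident : ∀ K x y → (+ 2 · x ⊕ (+ 3 + K) · y) ⊖ (+ 2 · x ⊕ + 2 · y) ≡ K · y ⊕ y
      ident K (Q , P) (Q' , P') = cong₂ _,_ (ring K Q Q') (ring K P P')
        where
        ring : ∀ K u v → (+ 2 * u + (+ 3 + K) * v) - (+ 2 * u + + 2 * v) ≡ K * v + v
        ring = solve-∀

module Convergents (a : ℕ → ℕ) (pq : PartialQuotients a) where
  open import Data.Integer using (_+_; _*_; _<_; _≤_; _^_)
  open Positivity a pq

  e : ℕ → Form
  e k = form (+ p a k) (q a k)

  -- q_k α − p_k has the sign (−1)^k
  δ : ℕ → Form
  δ k = -1ℤ ^ k · e k

  ±1 : ∀ k → -1ℤ ^ k ≡ 1ℤ ⊎ -1ℤ ^ k ≡ -1ℤ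
  ±1 zero = inj₁ refl
  ±1 (suc k) with ±1 k
  ... | inj₁ s≡1  = inj₂ (cong (-1ℤ *_) s≡1)
  ... | inj₂ s≡-1 = inj₁ (cong (-1ℤ *_) s≡-1)

  ±1-squared : ∀ k → -1ℤ ^ k * -1ℤ ^ k ≡ 1ℤ
  ±1-squared k with -1ℤ ^ k | ±1 k
  ... | _ | inj₁ refl = refl
  ... | _ | inj₂ refl = refl

  eval-self : ∀ N → eval N (e N) ≡ 0ℤ
  eval-self N = ident (+ q a N) (+ p a N)
    where
    ident : ∀ u v → u * v - v * u ≡ 0ℤ
    ident = solve-∀

  eval-swap : ∀ M N → eval M (e N) ≡ - eval N (e M)
  eval-swap M N = ident (+ q a N) (+ p a N) (+ q a M) (+ p a M)
    where
    ident : ∀ u v u' v' → u * v' - v * u' ≡ - (u' * v - v' * u)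
    ident = solve-∀

  determinant : ∀ k → eval (suc k) (e k) ≡ -1ℤ ^ k
  determinant zero = cong (λ n → + 1 * + (n ℕ.+ 1) - + 0 * + q a 1) (ℕP.*-zeroʳ (a 1))
  determinant (suc k) = begin
    eval (suc (suc k)) (e (suc k))
      ≡⟨ eval-rec k (e (suc k)) ⟩
    + a (suc (suc k)) * eval (suc k) (e (suc k)) + eval k (e (suc k))
      ≡⟨ cong₂ (λ u v → + a (suc (suc k)) * u + v) (eval-self (suc k)) (eval-swap k (suc k)) ⟩
    + a (suc (suc k)) * 0ℤ + - eval (suc k) (e k)
      ≡⟨ cong (λ u → + a (suc (suc k)) * 0ℤ + - u) (determinant k) ⟩
    + a (suc (suc k)) * 0ℤ + - (-1ℤ ^ k)
      ≡⟨ ident (+ a (suc (suc k))) (-1ℤ ^ k) ⟩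
    -1ℤ ^ suc k ∎
    where
    open ≡-Reasoning
    ident : ∀ A s → A * 0ℤ + - s ≡ -1ℤ * s
    ident = solve-∀

  positive-δ : ∀ k → Positive (δ k)
  positive-δ k = positive-from (δ k) k (ℤP.≤-reflexive (sym at-k)) (subst (0ℤ <_) (sym at-suc-k) (ℤ.+<+ (s≤s z≤n)))
    where
    open ≡-Reasoning
    at-k : eval k (δ k) ≡ 0ℤ
    at-k = begin
      eval k (δ k)              ≡⟨ eval-· k (-1ℤ ^ k) (e k) ⟩
      -1ℤ ^ k * eval k (e k)    ≡⟨ cong (-1ℤ ^ k *_) (eval-self k) ⟩
      -1ℤ ^ k * 0ℤ              ≡⟨ ℤP.*-zeroʳ (-1ℤ ^ k) ⟩
      0ℤ                        ∎
    at-suc-k : eval (suc k) (δ k) ≡ 1ℤ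
    at-suc-k = begin
      eval (suc k) (δ k)             ≡⟨ eval-· (suc k) (-1ℤ ^ k) (e k) ⟩
      -1ℤ ^ k * eval (suc k) (e k)   ≡⟨ cong (-1ℤ ^ k *_) (determinant k) ⟩
      -1ℤ ^ k * -1ℤ ^ k              ≡⟨ ±1-squared k ⟩
      1ℤ                             ∎

  partial-quotient-suc : ∀ k → ∃[ A ] a (suc k) ≡ suc A
  partial-quotient-suc k with a (suc k) | pq (suc k) (s≤s z≤n)
  ... | suc A | _ = A , refl

  e-rec : ∀ k → e (suc (suc k)) ≡ + a (suc (suc k)) · e (suc k) ⊕ e k
  e-rec k = cong₂ _,_ (pos-*-+ (a (suc (suc k))) (q a (suc k)) (q a k))
                      (pos-*-+ (a (suc (suc k))) (p a (suc k)) (p a k))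

  δ-rec : ∀ k → δ k ≡ + a (suc (suc k)) · δ (suc k) ⊕ δ (suc (suc k))
  δ-rec k = begin
    δ k
      ≡⟨ ident (-1ℤ ^ k) (+ a (suc (suc k))) (e (suc k)) (e k) ⟩
    + a (suc (suc k)) · δ (suc k) ⊕ -1ℤ ^ suc (suc k) · (+ a (suc (suc k)) · e (suc k) ⊕ e k)
      ≡⟨ cong (λ x → + a (suc (suc k)) · δ (suc k) ⊕ -1ℤ ^ suc (suc k) · x) (sym (e-rec k)) ⟩
    + a (suc (suc k)) · δ (suc k) ⊕ δ (suc (suc k)) ∎
    where
    open ≡-Reasoning
    ident : ∀ s A x y → s · y ≡ A · ((-1ℤ * s) · x) ⊕ (-1ℤ * (-1ℤ * s)) · (A · x ⊕ y)
    ident s A (Q , P) (Q' , P') = cong₂ _,_ (ring s A Q Q') (ring s A P P')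
      where
      ring : ∀ s A u v → s * v ≡ A * ((-1ℤ * s) * u) + (-1ℤ * (-1ℤ * s)) * (A * u + v)
      ring = solve-∀

  δ-decreasing : ∀ k → Positive (δ k ⊖ δ (suc k))
  δ-decreasing k with partial-quotient-suc (suc k)
  ... | A , a≡1+A = subst Positive (sym δₖ-δₖ₊₁≡)
    (positive-multiple-⊕ A (positive-δ (suc k)) (positive-δ (suc (suc k))))
    where
    open ≡-Reasoning
    ident : ∀ A x y → ((+ 1 + A) · x ⊕ y) ⊖ x ≡ A · x ⊕ y
    ident A (Q , P) (Q' , P') = cong₂ _,_ (ring A Q Q') (ring A P P')
      where
      ring : ∀ A u v → ((+ 1 + A) * u + v) - u ≡ A * u + v
      ring = solve-∀
    δₖ-δₖ₊₁≡ : δ k ⊖ δ (suc k) ≡ + A · δ (suc k) ⊕ δ (suc (suc k))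
    δₖ-δₖ₊₁≡ = begin
      δ k ⊖ δ (suc k)
        ≡⟨ cong (_⊖ δ (suc k)) (δ-rec k) ⟩
      (+ a (suc (suc k)) · δ (suc k) ⊕ δ (suc (suc k))) ⊖ δ (suc k)
        ≡⟨ cong (λ A → (+ A · δ (suc k) ⊕ δ (suc (suc k))) ⊖ δ (suc k)) a≡1+A ⟩
      (+ suc A · δ (suc k) ⊕ δ (suc (suc k))) ⊖ δ (suc k)
        ≡⟨ ident (+ A) (δ (suc k)) (δ (suc (suc k))) ⟩
      + A · δ (suc k) ⊕ δ (suc (suc k)) ∎

  double-decreasing : ∀ j → AbsLt a (+ 2 · e (suc j)) (+ 2 · e j)
  double-decreasing j =
    absLt-resp-≡± (·-≡± (+ 2) (≡±-unit (±1 (suc j)) (e (suc j)))) (·-≡± (+ 2) (≡±-unit (±1 j) (e j)))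
    (absLt-intro (positive-· 1 (positive-δ (suc j)))
      (subst Positive (sym (·-⊖-· (+ 2) (δ j) (δ (suc j)))) (positive-· 1 (δ-decreasing j))))

  lin : ℕ → ℤ → ℤ → Form
  lin m X Y = X · e m ⊕ Y · e (suc m)

  -- the basis e m, e (m + 1) is unimodular, with inverse given by eval (m + 1), eval m
  coordinates : ∀ m x → ∃[ X ] ∃[ Y ] x ≡ lin m X Y
  coordinates m (Q , P) = -1ℤ ^ m * eval (suc m) (Q , P) , - (-1ℤ ^ m) * eval m (Q , P) ,
    cong₂ _,_
    (sym (trans (ident (-1ℤ ^ m) Q P p₀ q₀ p₁ q₁) (unimodular Q)))
    (sym (trans (ident′ (-1ℤ ^ m) Q P p₀ q₀ p₁ q₁) (unimodular P)))
    where
    p₀ = + p a m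
    q₀ = + q a m
    p₁ = + p a (suc m)
    q₁ = + q a (suc m)
    ident : ∀ s Q P p₀ q₀ p₁ q₁ →
      (s * (Q * p₁ - P * q₁)) * q₀ + (- s * (Q * p₀ - P * q₀)) * q₁ ≡ (s * (q₀ * p₁ - p₀ * q₁)) * Q
    ident = solve-∀
    ident′ : ∀ s Q P p₀ q₀ p₁ q₁ →
      (s * (Q * p₁ - P * q₁)) * p₀ + (- s * (Q * p₀ - P * q₀)) * p₁ ≡ (s * (q₀ * p₁ - p₀ * q₁)) * P
    ident′ = solve-∀
    unimodular : ∀ i → (-1ℤ ^ m * eval (suc m) (e m)) * i ≡ i
    unimodular i = trans (cong (λ d → (-1ℤ ^ m * d) * i) (determinant m))
                         (trans (cong (_* i) (±1-squared m)) (ℤP.*-identityˡ i))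

  double-form : ∀ j → form (+ (2 ℕ.* p a j)) (2 ℕ.* q a j) ≡ + 2 · e j
  double-form j = cong₂ _,_ (ℤP.pos-* 2 (q a j)) (ℤP.pos-* 2 (p a j))

  double-not-convergent : ∀ j → ¬ IsConvergent a (+ (2 ℕ.* p a j)) (2 ℕ.* q a j)
  double-not-convergent j (k , P≡ , Q≡) = 2*n≢1 ∣ eval (suc k) (e j) ∣ (begin
    2 ℕ.* ∣ eval (suc k) (e j) ∣   ≡⟨ sym (ℤP.abs-* (+ 2) (eval (suc k) (e j))) ⟩
    ∣ + 2 * eval (suc k) (e j) ∣   ≡⟨ cong ∣_∣ (sym (eval-· (suc k) (+ 2) (e j))) ⟩
    ∣ eval (suc k) (+ 2 · e j) ∣   ≡⟨ cong (λ x → ∣ eval (suc k) x ∣) (sym eₖ≡2eⱼ) ⟩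
    ∣ eval (suc k) (e k) ∣         ≡⟨ cong ∣_∣ (determinant k) ⟩
    ∣ -1ℤ ^ k ∣                    ≡⟨ ∣±1∣ (±1 k) ⟩
    1 ∎)
    where
    open ≡-Reasoning
    open import Data.Integer using (∣_∣)
    eₖ≡2eⱼ : e k ≡ + 2 · e j
    eₖ≡2eⱼ = trans (cong₂ form (sym P≡) (sym Q≡)) (double-form j)
    ∣±1∣ : ∀ {s} → s ≡ 1ℤ ⊎ s ≡ -1ℤ → ∣ s ∣ ≡ 1
    ∣±1∣ (inj₁ refl) = refl
    ∣±1∣ (inj₂ refl) = refl
    2*n≢1 : ∀ n → 2 ℕ.* n ≢ 1
    2*n≢1 zero ()
    2*n≢1 (suc zero) ()
    2*n≢1 (suc (suc n)) ()

  lin-neg : ∀ m X Y → lin m (- X) (- Y) ≡ neg (lin m X Y)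
  lin-neg m X Y = cong₂ _,_ (ring X Y (+ q a m) (+ q a (suc m))) (ring X Y (+ p a m) (+ p a (suc m)))
    where
    ring : ∀ X Y u v → (- X) * u + (- Y) * v ≡ - (X * u + Y * v)
    ring = solve-∀

  -- e m and e (m + 1) have opposite signs
  lin-≡± : ∀ m X Y → lin m X Y ≡± X · δ m ⊕ (- Y) · δ (suc m)
  lin-≡± m X Y = combination-≡± (±1 m) X Y (e m) (e (suc m))

  double-previous-≡± : ∀ m → lin m -[1+ 1 ] (+ 2) ≡± + 2 · δ m ⊕ + 2 · δ (suc m)
  double-previous-≡± m = ≡±-trans (lin-≡± m -[1+ 1 ] (+ 2)) (inj₂ (ident (δ m) (δ (suc m))))
    where
    ident : ∀ x y → -[1+ 1 ] · x ⊕ -[1+ 1 ] · y ≡ neg (+ 2 · x ⊕ + 2 · y)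
    ident (Q , P) (Q' , P') = cong₂ _,_ (ring Q Q') (ring P P')
      where
      ring : ∀ u v → -[1+ 1 ] * u + -[1+ 1 ] * v ≡ - (+ 2 * u + + 2 * v)
      ring = solve-∀

  absLt-double-far₁ : ∀ m i k → AbsLt a (lin m -[1+ 1 ] (+ 2)) (lin m (+ (3 ℕ.+ i)) -[1+ k ])
  absLt-double-far₁ m i k = absLt-resp-≡± (double-previous-≡± m) (lin-≡± m (+ (3 ℕ.+ i)) -[1+ k ])
    (absLt-twice-sum₁ (δ m) (δ (suc m)) (positive-δ (suc m)) (δ-decreasing m) i k)

  absLt-double-far₂ : ∀ m k → AbsLt a (lin m -[1+ 1 ] (+ 2)) (lin m (+ 2) -[1+ 2 ℕ.+ k ])
  absLt-double-far₂ m k = absLt-resp-≡± (double-previous-≡± m) (lin-≡± m (+ 2) -[1+ 2 ℕ.+ k ])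
    (absLt-twice-sum₂ (δ m) (δ (suc m)) (positive-δ (suc m)) (δ-decreasing m) k)

  lin-first : ∀ m → lin m (+ 1) (+ 0) ≡ e m
  lin-first m = cong₂ _,_ (ring (+ q a m) (+ q a (suc m))) (ring (+ p a m) (+ p a (suc m)))
    where
    ring : ∀ u v → + 1 * u + + 0 * v ≡ u
    ring = solve-∀

  lin-second : ∀ m → lin m (+ 0) (+ 1) ≡ e (suc m)
  lin-second m = cong₂ _,_ (ring (+ q a m) (+ q a (suc m))) (ring (+ p a m) (+ p a (suc m)))
    where
    ring : ∀ u v → + 0 * u + + 1 * v ≡ v
    ring = solve-∀

  lin-double-first : ∀ m → lin m (+ 2) (+ 0) ≡ + 2 · e m
  lin-double-first m = cong₂ _,_ (ring (+ q a m) (+ q a (suc m))) (ring (+ p a m) (+ p a (suc m)))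
    where
    ring : ∀ u v → + 2 * u + + 0 * v ≡ + 2 * u
    ring = solve-∀

  e-rec-one : ∀ k → a (suc (suc k)) ≡ 1 → e (suc (suc k)) ≡ e (suc k) ⊕ e k
  e-rec-one k a≡1 = begin
    e (suc (suc k))                        ≡⟨ e-rec k ⟩
    + a (suc (suc k)) · e (suc k) ⊕ e k    ≡⟨ cong (λ A → + A · e (suc k) ⊕ e k) a≡1 ⟩
    + 1 · e (suc k) ⊕ e k                  ≡⟨ ident (e (suc k)) (e k) ⟩
    e (suc k) ⊕ e k                        ∎
    where
    open ≡-Reasoning
    ident : ∀ x y → + 1 · x ⊕ y ≡ x ⊕ y
    ident (Q , P) (Q' , P') = cong₂ _,_ (cong (_+ Q') (ℤP.*-identityˡ Q)) (cong (_+ P') (ℤP.*-identityˡ P))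

  module _ (k : ℕ) (a≡1 : a (suc (suc k)) ≡ 1) where
    private
      rewrite-last : ∀ X Y → lin (suc k) X Y ≡ X · e (suc k) ⊕ Y · (e (suc k) ⊕ e k)
      rewrite-last X Y = cong (λ x → X · e (suc k) ⊕ Y · x) (e-rec-one k a≡1)

    lin-previous : lin (suc k) -[1+ 0 ] (+ 1) ≡ e k
    lin-previous = trans (rewrite-last -[1+ 0 ] (+ 1)) (ident (e (suc k)) (e k))
      where
      ident : ∀ x y → -[1+ 0 ] · x ⊕ + 1 · (x ⊕ y) ≡ y
      ident (Q , P) (Q' , P') = cong₂ _,_ (ring Q Q') (ring P P')
        where
        ring : ∀ u v → -[1+ 0 ] * u + + 1 * (u + v) ≡ v
        ring = solve-∀

    lin-double-previous : lin (suc k) -[1+ 1 ] (+ 2) ≡ + 2 · e k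
    lin-double-previous = trans (rewrite-last -[1+ 1 ] (+ 2)) (ident (e (suc k)) (e k))
      where
      ident : ∀ x y → -[1+ 1 ] · x ⊕ + 2 · (x ⊕ y) ≡ + 2 · y
      ident (Q , P) (Q' , P') = cong₂ _,_ (ring Q Q') (ring P P')
        where
        ring : ∀ u v → -[1+ 1 ] * u + + 2 * (u + v) ≡ + 2 * v
        ring = solve-∀

    lin-exceptional : lin (suc k) -[1+ 0 ] (+ 2) ≡ e (suc k) ⊕ + 2 · e k
    lin-exceptional = trans (rewrite-last -[1+ 0 ] (+ 2)) (ident (e (suc k)) (e k))
      where
      ident : ∀ x y → -[1+ 0 ] · x ⊕ + 2 · (x ⊕ y) ≡ x ⊕ + 2 · y
      ident (Q , P) (Q' , P') = cong₂ _,_ (ring Q Q') (ring P P')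
        where
        ring : ∀ u v → -[1+ 0 ] * u + + 2 * (u + v) ≡ u + + 2 * v
        ring = solve-∀

  lin-before-previous : ∀ i → a (suc (suc i)) ≡ 1 → a (suc (suc (suc i))) ≡ 1 →
    lin (suc (suc i)) (+ 2) -[1+ 0 ] ≡ e i
  lin-before-previous i a₁≡1 a₂≡1 = begin
    + 2 · e (suc (suc i)) ⊕ -[1+ 0 ] · e (suc (suc (suc i)))
      ≡⟨ cong (λ x → + 2 · e (suc (suc i)) ⊕ -[1+ 0 ] · x) (e-rec-one (suc i) a₂≡1) ⟩
    + 2 · e (suc (suc i)) ⊕ -[1+ 0 ] · (e (suc (suc i)) ⊕ e (suc i))
      ≡⟨ cong (λ x → + 2 · x ⊕ -[1+ 0 ] · (x ⊕ e (suc i))) (e-rec-one i a₁≡1) ⟩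
    + 2 · (e (suc i) ⊕ e i) ⊕ -[1+ 0 ] · ((e (suc i) ⊕ e i) ⊕ e (suc i))
      ≡⟨ ident (e (suc i)) (e i) ⟩
    e i ∎
    where
    open ≡-Reasoning
    ident : ∀ x y → + 2 · (x ⊕ y) ⊕ -[1+ 0 ] · ((x ⊕ y) ⊕ x) ≡ y
    ident (Q , P) (Q' , P') = cong₂ _,_ (ring Q Q') (ring P P')
      where
      ring : ∀ u v → + 2 * (u + v) + -[1+ 0 ] * ((u + v) + u) ≡ v
      ring = solve-∀

  convergent-from-form : ∀ {P Q} k → form P Q ≡ e k → IsConvergent a P Q
  convergent-from-form k eq = k , cong proj₂ eq , ℤP.+-injective (cong proj₁ eq)

  module _ (m : ℕ) where
    private
      double-previous-≡±δ : lin m (+ 2) (+ 0) ≡± + 2 · δ m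
      double-previous-≡±δ = ≡±-trans (inj₁ (lin-double-first m)) (·-≡± (+ 2) (≡±-unit (±1 m) (e m)))

      exceptional-≡±δ : lin m -[1+ 0 ] (+ 2) ≡± + 1 · δ m ⊕ + 2 · δ (suc m)
      exceptional-≡±δ = ≡±-trans (lin-≡± m -[1+ 0 ] (+ 2)) (inj₂ (ident (δ m) (δ (suc m))))
        where
        ident : ∀ x y → -[1+ 0 ] · x ⊕ -[1+ 1 ] · y ≡ neg (+ 1 · x ⊕ + 2 · y)
        ident (Q , P) (Q' , P') = cong₂ _,_ (ring Q Q') (ring P P')
          where
          ring : ∀ u v → -[1+ 0 ] * u + -[1+ 1 ] * v ≡ - (+ 1 * u + + 2 * v)
          ring = solve-∀

      δ-rec-with : ∀ {A} → a (suc (suc m)) ≡ A → δ m ≡ + A · δ (suc m) ⊕ δ (suc (suc m))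
      δ-rec-with a≡A = trans (δ-rec m) (cong (λ A → + A · δ (suc m) ⊕ δ (suc (suc m))) a≡A)

    -- |2 e_m| against |2 e_{m+1} − e_m|; which one is smaller depends on whether a_{m+2} = 1
    absLt-double-exceptional : a (suc (suc m)) ≡ 1 → AbsLt a (lin m (+ 2) (+ 0)) (lin m -[1+ 0 ] (+ 2))
    absLt-double-exceptional a≡1 = absLt-resp-≡± double-previous-≡±δ exceptional-≡±δ
      (absLt-intro (positive-· 1 (positive-δ m))
        (subst Positive (sym (trans (cong (λ x → (+ 1 · x ⊕ + 2 · δ (suc m)) ⊖ + 2 · x) (δ-rec-with a≡1))
                                    (ident (δ (suc m)) (δ (suc (suc m))))))
               (δ-decreasing (suc m))))
      where
      ident : ∀ x y → (+ 1 · (+ 1 · x ⊕ y) ⊕ + 2 · x) ⊖ + 2 · (+ 1 · x ⊕ y) ≡ x ⊖ y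
      ident (Q , P) (Q' , P') = cong₂ _,_ (ring Q Q') (ring P P')
        where
        ring : ∀ u v → (+ 1 * (+ 1 * u + v) + + 2 * u) - + 2 * (+ 1 * u + v) ≡ u - v
        ring = solve-∀

    absLt-exceptional-double : ∀ b → a (suc (suc m)) ≡ 2 ℕ.+ b →
      AbsLt a (lin m -[1+ 0 ] (+ 2)) (lin m (+ 2) (+ 0))
    absLt-exceptional-double b a≡2+b = absLt-resp-≡± exceptional-≡±δ double-previous-≡±δ
      (absLt-intro (positive-⊕ (positive-· 0 (positive-δ m)) (positive-· 1 (positive-δ (suc m))))
        (subst Positive (sym (trans (cong (λ x → + 2 · x ⊖ (+ 1 · x ⊕ + 2 · δ (suc m))) (δ-rec-with a≡2+b))
                                    (ident (+ b) (δ (suc m)) (δ (suc (suc m))))))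
               (positive-multiple-⊕ b (positive-δ (suc m)) (positive-δ (suc (suc m))))))
      where
      ident : ∀ B x y →
        + 2 · ((+ 2 + B) · x ⊕ y) ⊖ (+ 1 · ((+ 2 + B) · x ⊕ y) ⊕ + 2 · x) ≡ B · x ⊕ y
      ident B (Q , P) (Q' , P') = cong₂ _,_ (ring B Q Q') (ring B P P')
        where
        ring : ∀ B u v →
          + 2 * ((+ 2 + B) * u + v) - (+ 1 * ((+ 2 + B) * u + v) + + 2 * u) ≡ B * u + v
        ring = solve-∀

open import Data.Nat using (_+_; _*_; _∸_; _≤_; _<_)

∸1< : ∀ {m n} → m < n → n ∸ 1 < n
∸1< {n = suc n} _ = ℕP.n<1+n n

module Denominators (a : ℕ → ℕ) (pq : PartialQuotients a) where

  q≤a*q : ∀ k → q a k ≤ a (suc k) * q a k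
  q≤a*q k = ℕP.≤-trans (ℕP.≤-reflexive (sym (ℕP.*-identityˡ (q a k))))
                       (ℕP.*-monoˡ-≤ (q a k) (pq (suc k) (s≤s z≤n)))

  q-step : ∀ k → q a k ≤ q a (suc k)
  q-step k = ℕP.≤-trans (q≤a*q k) (ℕP.m≤m+n (a (suc k) * q a k) _)

  q-positive : ∀ k → 1 ≤ q a k
  q-positive zero    = s≤s z≤n
  q-positive (suc k) = ℕP.≤-trans (q-positive k) (q-step k)

  q-increasing : ∀ k → q a (suc k) < q a (suc (suc k))
  q-increasing k =
    ℕP.<-≤-trans (ℕP.m<m+n (q a (suc k)) (q-positive k)) (ℕP.+-monoˡ-≤ (q a k) (q≤a*q (suc k)))

  q-monotone : ∀ {j k} → j ≤ k → q a j ≤ q a k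
  q-monotone {j} le with ℕP.m≤n⇒∃[o]m+o≡n le
  ... | d , refl = q-increasing-by d
    where
    q-increasing-by : ∀ d → q a j ≤ q a (j + d)
    q-increasing-by zero    = ℕP.≤-reflexive (cong (q a) (sym (ℕP.+-identityʳ j)))
    q-increasing-by (suc d) = ℕP.≤-trans (q-increasing-by d)
      (subst (λ k → q a (j + d) ≤ q a k) (sym (ℕP.+-suc j d)) (q-step (j + d)))

  q-rec-one : ∀ k → a (suc (suc k)) ≡ 1 → q a (suc (suc k)) ≡ q a (suc k) + q a k
  q-rec-one k a≡1 =
    trans (cong (λ A → A * q a (suc k) + q a k) a≡1) (cong (_+ q a k) (ℕP.*-identityˡ (q a (suc k))))

module CoordinateBounds {x w : ℕ} (1≤x : 1 ≤ x) (x<w : x < w) (w<x+x : w < x + x) where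
  open ℕP.≤-Reasoning

  private
    2x≡x+x : 2 * x ≡ x + x
    2x≡x+x = cong (λ v → x + v) (ℕP.+-identityʳ x)

  w≤2x : w ≤ 2 * x
  w≤2x = subst (w ≤_) (sym 2x≡x+x) (ℕP.<⇒≤ w<x+x)

  2x<[3+k]x : ∀ k → 2 * x + 0 < (3 + k) * x + 0
  2x<[3+k]x k = ℕP.+-monoˡ-< 0 (begin-strict
    2 * x          <⟨ ℕP.m<n+m (2 * x) 1≤x ⟩
    3 * x          ≤⟨ ℕP.*-monoˡ-≤ x (ℕP.m≤m+n 3 k) ⟩
    (3 + k) * x    ∎)

  2x<[2+l]w : ∀ l → 2 * x + 0 < (2 + l) * w
  2x<[2+l]w l = begin-strict
    2 * x + 0      ≡⟨ trans (ℕP.+-identityʳ (2 * x)) 2x≡x+x ⟩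
    x + x          <⟨ ℕP.+-mono-< x<w x<w ⟩
    w + w          ≤⟨ ℕP.+-monoʳ-≤ w (ℕP.m≤m+n w (l * w)) ⟩
    (2 + l) * w    ∎

  2x<[1+k]x+[1+l]w : ∀ k l → 2 * x + 0 < suc k * x + suc l * w
  2x<[1+k]x+[1+l]w k l = begin-strict
    2 * x + 0                ≡⟨ trans (ℕP.+-identityʳ (2 * x)) 2x≡x+x ⟩
    x + x                    <⟨ ℕP.+-monoʳ-< x x<w ⟩
    x + w                    ≤⟨ ℕP.+-mono-≤ (ℕP.m≤m+n x (k * x)) (ℕP.m≤m+n w (l * w)) ⟩
    suc k * x + suc l * w    ∎

  3x<[3+l]w : ∀ l → 2 * x + (1 * x + 0) < (3 + l) * w
  3x<[3+l]w l = begin-strict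
    2 * x + (1 * x + 0)    ≡⟨ ident x ⟩
    x + (x + x)            <⟨ ℕP.+-mono-< x<w (ℕP.+-mono-< x<w x<w) ⟩
    w + (w + w)            ≤⟨ ℕP.+-monoʳ-≤ w (ℕP.+-monoʳ-≤ w (ℕP.m≤m+n w (l * w))) ⟩
    (3 + l) * w            ∎
    where
    ident : ∀ x → 2 * x + (1 * x + 0) ≡ x + (x + x)
    ident = ℕ-Solver.solve-∀

  x≤[1+l]w : ∀ l → 1 * x + 0 ≤ suc l * w
  x≤[1+l]w l = begin
    1 * x + 0      ≡⟨ trans (ℕP.+-identityʳ (1 * x)) (ℕP.*-identityˡ x) ⟩
    x              ≤⟨ ℕP.<⇒≤ x<w ⟩
    w              ≤⟨ ℕP.m≤m+n w (l * w) ⟩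
    suc l * w      ∎

  2x≤[2+l]w : ∀ l → 2 * x + 0 ≤ (2 + l) * w
  2x≤[2+l]w l = ℕP.<⇒≤ (2x<[2+l]w l)

  w≤[2+k]x : ∀ k → w + 0 ≤ (2 + k) * x + 0
  w≤[2+k]x k = ℕP.+-monoˡ-≤ 0 (ℕP.≤-trans w≤2x (ℕP.*-monoˡ-≤ x (ℕP.m≤m+n 2 k)))

module Classification (a : ℕ → ℕ) (pq : PartialQuotients a) where
  open Positivity a pq
  open Convergents a pq
  open Denominators a pq

  -- Here j = i + 1; far means |Qα − P| > |2 e j|, and the exceptional point can only occur for j = 1.
  data TopPoint (i : ℕ) (P : ℤ) (Q : ℕ) : Set where
    double-next : form P Q ≡ + 2 · e (suc (suc i)) → TopPoint i P Q
    exceptional : q a (suc i) ≤ q a i → form P Q ≡ e (suc (suc i)) ⊕ + 2 · e (suc i) → TopPoint i P Q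

  data Shape (i : ℕ) (P : ℤ) (Q : ℕ) : Set where
    convergent : IsConvergent a P Q → Shape i P Q
    double     : form P Q ≡ + 2 · e (suc i) → Shape i P Q
    top        : 2 * q a (suc (suc i)) ≤ Q → TopPoint i P Q → Shape i P Q
    far        : AbsLt a (+ 2 · e (suc i)) (form P Q) → Shape i P Q

  shape : ∀ i → a (suc (suc i)) ≡ 1 → a (suc (suc (suc i))) ≡ 1 →
          ∀ P Q → 1 ≤ Q → Q ≤ 2 * q a (suc (suc i)) → Shape i P Q
  shape i a₁≡1 a₂≡1 P Q 1≤Q Q≤2x = by-coordinates (coordinates m (form P Q))
    where
    open ℕP.≤-Reasoning
    j m x w y z : ℕ
    j = suc i
    m = suc j
    x = q a m
    w = q a (suc m)
    y = q a j
    z = q a i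

    x≡y+z : x ≡ y + z
    x≡y+z = q-rec-one i a₁≡1
    w≡x+y : w ≡ x + y
    w≡x+y = q-rec-one j a₂≡1
    z≤y : z ≤ y
    z≤y = q-step i
    x<w : x < w
    x<w = subst (x <_) (sym w≡x+y) (ℕP.m<m+n x (q-positive j))
    w<x+x : w < x + x
    w<x+x = subst (_< x + x) (sym w≡x+y)
                  (ℕP.+-monoʳ-< x (subst (y <_) (sym x≡y+z) (ℕP.m<m+n y (q-positive i))))
    open CoordinateBounds (q-positive m) x<w w<x+x

    too-big : ∀ {n R} → 2 * x + n < R → Q + n ≡ R → ⊥
    too-big lt E = ℕP.<⇒≱ lt (subst (_≤ 2 * x + _) E (ℕP.+-monoˡ-≤ _ Q≤2x))
    too-small : ∀ {n R} → R ≤ n → Q + n ≡ R → ⊥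
    too-small le E = ℕP.<⇒≱ (subst (_ <_) E (ℕP.m<n+m _ 1≤Q)) le

    -- the point with coordinates (-1, 2) has Q = x + 2 y ≥ 2 x, with Q ≤ 2 x only if y ≤ z
    module _ (E : Q + (1 * x + 0) ≡ 2 * w) where
      private
        E′ : Q + x ≡ 2 * w
        E′ = trans (cong (λ v → Q + v) (sym (trans (ℕP.+-identityʳ (1 * x)) (ℕP.*-identityˡ x)))) E
        3x≡ : 2 * x + x ≡ (3 * y + 2 * z) + z
        3x≡ = trans (cong (λ x → 2 * x + x) x≡y+z) (ident y z)
          where
          ident : ∀ y z → 2 * (y + z) + (y + z) ≡ (3 * y + 2 * z) + z
          ident = ℕ-Solver.solve-∀
        2w≡ : 2 * w ≡ (3 * y + 2 * z) + y
        2w≡ = trans (cong (2 *_) (trans w≡x+y (cong (_+ y) x≡y+z))) (ident y z)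
          where
          ident : ∀ y z → 2 * ((y + z) + y) ≡ (3 * y + 2 * z) + y
          ident = ℕ-Solver.solve-∀

      exceptional-large : 2 * x ≤ Q
      exceptional-large = ℕP.+-cancelʳ-≤ x (2 * x) Q (begin
        2 * x + x                ≡⟨ 3x≡ ⟩
        (3 * y + 2 * z) + z      ≤⟨ ℕP.+-monoʳ-≤ (3 * y + 2 * z) z≤y ⟩
        (3 * y + 2 * z) + y      ≡⟨ sym 2w≡ ⟩
        2 * w                    ≡⟨ sym E′ ⟩
        Q + x                    ∎)

      exceptional-y≤z : y ≤ z
      exceptional-y≤z = ℕP.+-cancelˡ-≤ (3 * y + 2 * z) y z (begin
        (3 * y + 2 * z) + y      ≡⟨ sym 2w≡ ⟩
        2 * w                    ≡⟨ sym E′ ⟩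
        Q + x                    ≤⟨ ℕP.+-monoˡ-≤ x Q≤2x ⟩
        2 * x + x                ≡⟨ 3x≡ ⟩
        (3 * y + 2 * z) + z      ∎)

    classify : ∀ X Y → form P Q ≡ lin m X Y →
      Q + (negative-part X * x + negative-part Y * w) ≡ positive-part X * x + positive-part Y * w → Shape i P Q
    classify (+ 0) (+ 0) _ E = ⊥-elim (too-small z≤n E)
    classify (+ 1) (+ 0) eq _ = convergent (convergent-from-form m (trans eq (lin-first m)))
    classify (+ 2) (+ 0) eq E =
      top (ℕP.≤-reflexive (ℕP.+-cancelʳ-≡ 0 _ _ (sym E))) (double-next (trans eq (lin-double-first m)))
    classify (+ suc (suc (suc k))) (+ 0) _ E = ⊥-elim (too-big (2x<[3+k]x k) E)
    classify (+ 0) (+ 1) eq _ = convergent (convergent-from-form (suc m) (trans eq (lin-second m)))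
    classify (+ 0) (+ suc (suc l)) _ E = ⊥-elim (too-big (2x<[2+l]w l) E)
    classify (+ suc k) (+ suc l) _ E = ⊥-elim (too-big (2x<[1+k]x+[1+l]w k l) E)
    classify (+ 0) -[1+ l ] _ E = ⊥-elim (too-small z≤n E)
    classify (+ 1) -[1+ l ] _ E = ⊥-elim (too-small (x≤[1+l]w l) E)
    classify (+ 2) -[1+ 0 ] eq _ =
      convergent (convergent-from-form i (trans eq (lin-before-previous i a₁≡1 a₂≡1)))
    classify (+ 2) -[1+ suc l ] _ E = ⊥-elim (too-small (2x≤[2+l]w l) E)
    classify (+ suc (suc (suc k))) -[1+ l ] eq _ =
      far (subst₂ (AbsLt a) (lin-double-previous j a₂≡1) (sym eq) (absLt-double-far₁ m k l))
    classify -[1+ k ] (+ 0) _ E = ⊥-elim (too-small z≤n E)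
    classify -[1+ 0 ] (+ 1) eq _ = convergent (convergent-from-form j (trans eq (lin-previous j a₂≡1)))
    classify -[1+ 0 ] (+ 2) eq E =
      top (exceptional-large E) (exceptional (exceptional-y≤z E) (trans eq (lin-exceptional j a₂≡1)))
    classify -[1+ 0 ] (+ suc (suc (suc l))) _ E = ⊥-elim (too-big (3x<[3+l]w l) E)
    classify -[1+ 1 ] (+ 1) _ E = ⊥-elim (too-small (w≤[2+k]x 0) E)
    classify -[1+ 1 ] (+ 2) eq _ = double (trans eq (lin-double-previous j a₂≡1))
    classify -[1+ 1 ] (+ suc (suc (suc l))) eq _ =
      far (subst₂ (AbsLt a) (lin-double-previous j a₂≡1) (sym (trans eq (lin-neg m (+ 2) -[1+ 2 + l ])))
                 (absLt-negʳ {lin m -[1+ 1 ] (+ 2)} {lin m (+ 2) -[1+ 2 + l ]}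
                   (absLt-double-far₂ m l)))
    classify -[1+ suc (suc k) ] (+ 1) _ E = ⊥-elim (too-small (w≤[2+k]x (suc k)) E)
    classify -[1+ suc (suc k) ] (+ suc (suc l)) eq _ =
      far (subst₂ (AbsLt a) (lin-double-previous j a₂≡1) (sym (trans eq (lin-neg m (+ (3 + k)) -[1+ suc l ])))
                 (absLt-negʳ {lin m -[1+ 1 ] (+ 2)} {lin m (+ (3 + k)) -[1+ suc l ]}
                   (absLt-double-far₁ m k (suc l))))
    classify -[1+ k ] -[1+ l ] _ E = ⊥-elim (too-small z≤n E)

    by-coordinates : ∃[ X ] ∃[ Y ] form P Q ≡ lin m X Y → Shape i P Q
    by-coordinates (X , Y , eq) = classify X Y eq (coefficient-parts X Y (cong proj₁ eq))

module Minimizers (a : ℕ → ℕ) (pq : PartialQuotients a) where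
  open Positivity a pq
  open Convergents a pq
  open Denominators a pq
  open Classification a pq

  infix 4 _≼_

  _≼_ : Form → Form → Set
  x ≼ y = y ≡ x ⊎ AbsLt a x y

  StrictMinimizer : ℕ → ℤ → ℕ → Set
  StrictMinimizer t P Q = Admissible a t P Q × (∀ P' Q' → Admissible a t P' Q' → form P Q ≼ form P' Q')

  strictMinimizer⇒minimizer : ∀ {t P Q} → StrictMinimizer t P Q → Minimizer a t P Q
  strictMinimizer⇒minimizer {t} {P} {Q} (adm , beats) = adm , not-below
    where
    not-below : ∀ P' Q' → Admissible a t P' Q' → ¬ AbsLt a (form P' Q') (form P Q)
    not-below P' Q' adm' with beats P' Q' adm'
    ... | inj₁ eq = λ lt → absLt-irrefl {form P Q} (subst (λ x → AbsLt a x (form P Q)) eq lt)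
    ... | inj₂ gt = absLt-asym {form P Q} {form P' Q'} gt

  strictMinimizer-unique : ∀ {t P Q P' Q'} → StrictMinimizer t P Q → Minimizer a t P' Q' →
    form P' Q' ≡ form P Q
  strictMinimizer-unique {P = P} {Q} {P'} {Q'} (adm , beats) (adm' , minimal) with beats P' Q' adm'
  ... | inj₁ eq = eq
  ... | inj₂ gt = ⊥-elim (minimal P Q adm gt)

  no-discontinuity : ∀ {k P Q} → StrictMinimizer k P Q → StrictMinimizer (k ∸ 1) P Q → ¬ Discontinuity a k
  no-discontinuity {P = P} {Q} sm sm' (_ , P₁ , Q₁ , P₂ , Q₂ , min₁ , min₂ , lt) =
    [ (λ lt → absLt-irrefl {form P Q} (subst₂ (AbsLt a) eq₁ eq₂ lt))
    , (λ lt → absLt-irrefl {form P Q} (subst₂ (AbsLt a) eq₂ eq₁ lt)) ]′ lt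
    where
    eq₁ = strictMinimizer-unique sm min₁
    eq₂ = strictMinimizer-unique sm' min₂

  doubled-admissible : ∀ j {t} → 2 * q a j ≤ t → Admissible a t (+ (2 * p a j)) (2 * q a j)
  doubled-admissible j le = (ℕP.≤-trans (q-positive j) (ℕP.m≤m+n (q a j) _) , le) , double-not-convergent j

  range-strictMinimizer : ∀ i → a (suc (suc i)) ≡ 1 → a (suc (suc (suc i))) ≡ 1 → ∀ {t} →
    2 * q a (suc i) ≤ t → t < 2 * q a (suc (suc i)) →
    StrictMinimizer t (+ (2 * p a (suc i))) (2 * q a (suc i))
  range-strictMinimizer i a₁≡1 a₂≡1 {t} lo hi = doubled-admissible (suc i) lo , beats
    where
    M : Form
    M = form (+ (2 * p a (suc i))) (2 * q a (suc i))
    beats : ∀ P Q → Admissible a t P Q → M ≼ form P Q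
    beats P Q ((1≤Q , Q≤t) , not-convergent) =
      by-shape (shape i a₁≡1 a₂≡1 P Q 1≤Q (ℕP.≤-trans Q≤t (ℕP.<⇒≤ hi)))
      where
      by-shape : Shape i P Q → M ≼ form P Q
      by-shape (convergent c) = ⊥-elim (not-convergent c)
      by-shape (double eq)    = inj₁ (trans eq (sym (double-form (suc i))))
      by-shape (top large _)  = ⊥-elim (ℕP.<⇒≱ (ℕP.≤-<-trans Q≤t hi) large)
      by-shape (far lt)       = inj₂ (subst (λ x → AbsLt a x (form P Q)) (sym (double-form (suc i))) lt)

  top-strictMinimizer : ∀ i → a (suc (suc i)) ≡ 1 → a (suc (suc (suc i))) ≡ 1 → ∀ {P Q} →
    Admissible a (2 * q a (suc (suc i))) P Q → AbsLt a (form P Q) (+ 2 · e (suc i)) →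
    (∀ {P' Q'} → TopPoint i P' Q' → form P Q ≼ form P' Q') →
    StrictMinimizer (2 * q a (suc (suc i))) P Q
  top-strictMinimizer i a₁≡1 a₂≡1 {P} {Q} adm below top-points = adm , beats
    where
    beats : ∀ P' Q' → Admissible a (2 * q a (suc (suc i))) P' Q' → form P Q ≼ form P' Q'
    beats P' Q' ((1≤Q' , Q'≤t) , not-convergent) = by-shape (shape i a₁≡1 a₂≡1 P' Q' 1≤Q' Q'≤t)
      where
      by-shape : Shape i P' Q' → form P Q ≼ form P' Q'
      by-shape (convergent c) = ⊥-elim (not-convergent c)
      by-shape (double eq)    = inj₂ (subst (AbsLt a (form P Q)) (sym eq) below)
      by-shape (top _ point)  = top-points point
      by-shape (far lt)       = inj₂ (absLt-trans {form P Q} {+ 2 · e (suc i)} {form P' Q'} below lt)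

  successive-doubles : ∀ i → a (suc (suc i)) ≡ 1 → a (suc (suc (suc i))) ≡ 1 → ∀ {P Q P' Q'} →
    Minimizer a (2 * q a (suc i) ∸ 1) P Q → AbsLt a (+ 2 · e (suc i)) (form P Q) →
    Minimizer a (2 * q a (suc (suc i))) P' Q' → AbsLt a (form P' Q') (+ 2 · e (suc i)) →
    Successive a (2 * q a (suc i)) (2 * q a (suc (suc i)))
  successive-doubles i a₁≡1 a₂≡1 {P} {Q} {P'} {Q'} min-below below min-above above =
    inj₂ lower , inj₂ upper , doubles< , between
    where
    M-P = + (2 * p a (suc i))
    M-Q = 2 * q a (suc i)
    range = range-strictMinimizer i a₁≡1 a₂≡1
    doubles< : 2 * q a (suc i) < 2 * q a (suc (suc i))
    doubles< = ℕP.*-monoʳ-< 2 (q-increasing i)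
    lower : Discontinuity a (2 * q a (suc i))
    lower = ℕP.*-monoʳ-≤ 2 (q-positive (suc i)) , M-P , M-Q , P , Q ,
            strictMinimizer⇒minimizer (range ℕP.≤-refl doubles<) , min-below ,
            inj₁ (subst (λ x → AbsLt a x (form P Q)) (sym (double-form (suc i))) below)
    upper : Discontinuity a (2 * q a (suc (suc i)))
    upper = ℕP.*-monoʳ-≤ 2 (q-positive (suc (suc i))) , P' , Q' , M-P , M-Q ,
            min-above , strictMinimizer⇒minimizer (range (ℕP.<⇒≤pred doubles<) (∸1< doubles<)) ,
            inj₁ (subst (AbsLt a (form P' Q')) (sym (double-form (suc i))) above)
    between : ∀ k → 2 * q a (suc i) < k → k < 2 * q a (suc (suc i)) → ¬ InQ a k
    between k lo hi (inj₁ refl) = ℕP.<⇒≱ lo (ℕP.≤-trans (s≤s z≤n) (ℕP.*-monoʳ-≤ 2 (q-positive (suc i))))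
    between k lo hi (inj₂ disc) = no-discontinuity (range (ℕP.<⇒≤ lo) hi)
      (range (ℕP.<⇒≤pred lo) (ℕP.≤-<-trans (ℕP.m∸n≤m k 1) hi)) disc

  successive-doubles-later : ∀ i →
    a (suc (suc i)) ≡ 1 → a (suc (suc (suc i))) ≡ 1 → a (suc (suc (suc (suc i)))) ≡ 1 →
    Successive a (2 * q a (suc (suc i))) (2 * q a (suc (suc (suc i))))
  successive-doubles-later i a₀≡1 a₁≡1 a₂≡1 = successive-doubles (suc i) a₁≡1 a₂≡1
    (strictMinimizer⇒minimizer (range-strictMinimizer i a₀≡1 a₁≡1 (ℕP.<⇒≤pred doubles<) (∸1< doubles<)))
    (subst (AbsLt a (+ 2 · e (suc (suc i)))) (sym (double-form (suc i))) (double-decreasing (suc i)))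
    (strictMinimizer⇒minimizer top-minimizer)
    below-next
    where
    n = suc (suc i)
    doubles< : 2 * q a (suc i) < 2 * q a n
    doubles< = ℕP.*-monoʳ-< 2 (q-increasing i)
    below-next : AbsLt a (form (+ (2 * p a (suc n))) (2 * q a (suc n))) (+ 2 · e n)
    below-next = subst (λ x → AbsLt a x (+ 2 · e n)) (sym (double-form (suc n))) (double-decreasing n)
    top-points : ∀ {P Q} → TopPoint (suc i) P Q → form (+ (2 * p a (suc n))) (2 * q a (suc n)) ≼ form P Q
    top-points (double-next eq)   = inj₁ (trans eq (sym (double-form (suc n))))
    top-points (exceptional q≤ _) = ⊥-elim (ℕP.<⇒≱ (q-increasing i) q≤)
    top-minimizer : StrictMinimizer (2 * q a (suc n)) (+ (2 * p a (suc n))) (2 * q a (suc n))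
    top-minimizer =
      top-strictMinimizer (suc i) a₁≡1 a₂≡1 (doubled-admissible (suc n) ℕP.≤-refl) below-next top-points

module FirstPair (a : ℕ → ℕ) (pq : PartialQuotients a) (a₁≡1 : a 1 ≡ 1) (a₂≡1 : a 2 ≡ 1) (a₃≡1 : a 3 ≡ 1)
  where
  open Positivity a pq
  open Convergents a pq
  open Denominators a pq
  open Classification a pq
  open Minimizers a pq

  q₁≡1 : q a 1 ≡ 1
  q₁≡1 = cong (λ A → A * 1 + 0) a₁≡1

  p₁≡1 : p a 1 ≡ 1
  p₁≡1 = cong (λ A → A * 0 + 1) a₁≡1

  q₂≡2 : q a 2 ≡ 2
  q₂≡2 = cong₂ (λ A q₁ → A * q₁ + 1) a₂≡1 q₁≡1

  p₂≡1 : p a 2 ≡ 1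
  p₂≡1 = cong₂ (λ A p₁ → A * p₁ + 0) a₂≡1 p₁≡1

  q₃≡3 : q a 3 ≡ 3
  q₃≡3 = trans (cong₂ (λ A q₂ → A * q₂ + q a 1) a₃≡1 q₂≡2) (cong (λ q₁ → 2 + q₁) q₁≡1)

  e₁ : e 1 ≡ (+ 1 , + 1)
  e₁ = cong₂ (λ q₁ p₁ → (+ q₁ , + p₁)) q₁≡1 p₁≡1

  e₂ : e 2 ≡ (+ 2 , + 1)
  e₂ = cong₂ (λ q₂ p₂ → (+ q₂ , + p₂)) q₂≡2 p₂≡1

  δ₁ : δ 1 ≡ (-[1+ 0 ] , -[1+ 0 ])
  δ₁ = cong (-1ℤ ℤ.^ 1 ·_) e₁

  -- 1 = α + (1 − α) = δ 0 + δ 1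
  positive-one : Positive (+ 0 , -[1+ 0 ])
  positive-one = subst Positive (cong (δ 0 ⊕_) δ₁) (positive-⊕ (positive-δ 0) (positive-δ 1))

  positive-constant : ∀ t → Positive (+ 0 , -[1+ t ])
  positive-constant t = subst Positive
    (cong₂ _,_ (ℤP.*-zeroʳ +[1+ t ]) (trans (ℤP.*-comm +[1+ t ] -1ℤ) (ℤP.-1*i≡-i +[1+ t ])))
    (positive-· t positive-one)

  two-minus-α : Positive (-[1+ 0 ] , -[1+ 1 ])
  two-minus-α = subst Positive (cong (_⊕ (+ 0 , -[1+ 0 ])) δ₁) (positive-⊕ (positive-δ 1) positive-one)

  -- ψ^[2](1) = 2 − α, attained at (P , Q) = (2 , 1)
  bottom-not-convergent : ¬ IsConvergent a (+ 2) 1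
  bottom-not-convergent (zero , () , _)
  bottom-not-convergent (suc zero , 2≡p₁ , _) with trans (ℤP.+-injective 2≡p₁) p₁≡1
  ... | ()
  bottom-not-convergent (suc (suc k) , _ , 1≡q) =
    ℕP.<⇒≱ (ℕP.n<1+n 1) (subst₂ _≤_ q₂≡2 (sym 1≡q) (q-monotone (s≤s (s≤s z≤n))))

  bottom-strictMinimizer : StrictMinimizer 1 (+ 2) 1
  bottom-strictMinimizer = ((s≤s z≤n , s≤s z≤n) , bottom-not-convergent) , beats
    where
    M 2-α : Form
    M = form (+ 2) 1
    2-α = -[1+ 0 ] , -[1+ 1 ]
    beats-at-1 : ∀ P → ¬ IsConvergent a P 1 → M ≼ form P 1
    beats-at-1 (+ 0) not-convergent = ⊥-elim (not-convergent (0 , refl , refl))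
    beats-at-1 (+ 1) not-convergent = ⊥-elim (not-convergent (1 , cong +_ (sym p₁≡1) , sym q₁≡1))
    beats-at-1 (+ 2) _ = inj₁ refl
    -- |α − 3 − t| − |α − 2| = 1 + t
    beats-at-1 (+ suc (suc (suc t))) _ =
      inj₂ (absLt-resp-≡± {x' = 2-α} {y' = -[1+ 0 ] , -[1+ suc (suc t) ]} (inj₂ refl) (inj₂ refl)
             (absLt-intro {y = -[1+ 0 ] , -[1+ suc (suc t) ]} two-minus-α (positive-constant t)))
    -- |α + 1 + t| − |α − 2| = t + (2 α − 1) = t + δ 2
    beats-at-1 -[1+ t ] _ = inj₂ (absLt-resp-≡± {x' = 2-α} {y' = + 1 , -[1+ t ]} (inj₂ refl) (inj₁ refl)
      (absLt-intro {y = + 1 , -[1+ t ]} two-minus-α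
        (subst Positive (sym (cong₂ _,_ (ident₁ (+ t)) (ident₂ (+ t))))
          (positive-multiple-⊕ t positive-one (subst Positive (cong (-1ℤ ℤ.^ 2 ·_) e₂) (positive-δ 2))))))
      where
      ident₁ : ∀ T → + 1 ℤ.- -[1+ 0 ] ≡ T ℤ.* + 0 ℤ.+ + 2
      ident₁ = solve-∀
      ident₂ : ∀ T → ℤ.- (+ 1 ℤ.+ T) ℤ.- -[1+ 1 ] ≡ T ℤ.* -[1+ 0 ] ℤ.+ + 1
      ident₂ = solve-∀
    at-1 : ∀ P Q → Q ≡ 1 → ¬ IsConvergent a P Q → M ≼ form P Q
    at-1 P .1 refl = beats-at-1 P
    beats : ∀ P Q → Admissible a 1 P Q → M ≼ form P Q
    beats P Q ((1≤Q , Q≤1) , not-convergent) = at-1 P Q (ℕP.≤-antisym Q≤1 1≤Q) not-convergent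

  double-first-below : AbsLt a (+ 2 · e 1) (form (+ 2) 1)
  double-first-below =
    absLt-resp-≡± {x' = -[1+ 1 ] , -[1+ 1 ]} {y' = -[1+ 0 ] , -[1+ 1 ]} (inj₂ (cong (+ 2 ·_) e₁)) (inj₂ refl)
      (absLt-intro {y = -[1+ 0 ] , -[1+ 1 ]} (subst Positive (cong (+ 2 ·_) δ₁) (positive-· 1 (positive-δ 1)))
                   (positive-δ 0))

  -- at t = 4 the minimum is |4 α − 2| when a₄ = 1, and |4 α − 3| otherwise
  top-minimizer : ∃[ A ] a 4 ≡ suc A →
    ∃[ P ] ∃[ Q ] Minimizer a (2 * q a 2) P Q × AbsLt a (form P Q) (+ 2 · e 1)
  top-minimizer (zero , a₄≡1) =
    + (2 * p a 2) , 2 * q a 2 ,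
    strictMinimizer⇒minimizer (top-strictMinimizer 0 a₂≡1 a₃≡1 (doubled-admissible 2 ℕP.≤-refl) below points) ,
    below
    where
    below : AbsLt a (form (+ (2 * p a 2)) (2 * q a 2)) (+ 2 · e 1)
    below = subst (λ x → AbsLt a x (+ 2 · e 1)) (sym (double-form 2)) (double-decreasing 1)
    points : ∀ {P Q} → TopPoint 0 P Q → form (+ (2 * p a 2)) (2 * q a 2) ≼ form P Q
    points (double-next eq)   = inj₁ (trans eq (sym (double-form 2)))
    points (exceptional _ eq) = inj₂ (subst₂ (AbsLt a) (trans (lin-double-first 2) (sym (double-form 2)))
                                                     (trans (lin-exceptional 1 a₃≡1) (sym eq))
                                                     (absLt-double-exceptional 2 a₄≡1))
  top-minimizer (suc b , a₄≡2+b) =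
    + 3 , 4 ,
    strictMinimizer⇒minimizer (top-strictMinimizer 0 a₂≡1 a₃≡1 admissible below points) ,
    below
    where
    X : Form
    X = form (+ 3) 4
    X≡ : X ≡ e 2 ⊕ + 2 · e 1
    X≡ = sym (cong₂ (λ x y → x ⊕ + 2 · y) e₂ e₁)
    X<double : AbsLt a X (+ 2 · e 2)
    X<double = subst₂ (AbsLt a) (trans (lin-exceptional 1 a₃≡1) (sym X≡)) (lin-double-first 2)
                      (absLt-exceptional-double 2 b a₄≡2+b)
    below : AbsLt a X (+ 2 · e 1)
    below = absLt-trans {X} {+ 2 · e 2} {+ 2 · e 1} X<double (double-decreasing 1)
    5≤q₄ : 5 ≤ q a 4
    5≤q₄ = subst (5 ≤_)
      (sym (trans (cong₂ (λ A q₃ → A * q₃ + q a 2) a₄≡2+b q₃≡3) (cong (λ q₂ → (2 + b) * 3 + q₂) q₂≡2)))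
      (s≤s (s≤s (s≤s (s≤s (s≤s z≤n)))))
    not-convergent : ¬ IsConvergent a (+ 3) 4
    not-convergent (zero , _ , ())
    not-convergent (suc zero , _ , 4≡q₁) with trans 4≡q₁ q₁≡1
    ... | ()
    not-convergent (suc (suc zero) , _ , 4≡q₂) with trans 4≡q₂ q₂≡2
    ... | ()
    not-convergent (suc (suc (suc zero)) , _ , 4≡q₃) with trans 4≡q₃ q₃≡3
    ... | ()
    not-convergent (suc (suc (suc (suc k))) , _ , 4≡q) =
      ℕP.<⇒≱ (ℕP.≤-trans 5≤q₄ (q-monotone (s≤s (s≤s (s≤s (s≤s z≤n)))))) (ℕP.≤-reflexive (sym 4≡q))
    admissible : Admissible a (2 * q a 2) (+ 3) 4
    admissible = (s≤s z≤n , ℕP.≤-reflexive (sym (cong (2 *_) q₂≡2))) , not-convergent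
    points : ∀ {P Q} → TopPoint 0 P Q → X ≼ form P Q
    points (double-next eq)   = inj₂ (subst (AbsLt a X) (sym eq) X<double)
    points (exceptional _ eq) = inj₁ (trans eq (sym X≡))

  successive-doubles-first : Successive a (2 * q a 1) (2 * q a 2)
  successive-doubles-first = from-top (top-minimizer (partial-quotient-suc 3))
    where
    from-top : ∃[ P ] ∃[ Q ] Minimizer a (2 * q a 2) P Q × AbsLt a (form P Q) (+ 2 · e 1) →
      Successive a (2 * q a 1) (2 * q a 2)
    from-top (P , Q , minimal , above) = successive-doubles 0 a₂≡1 a₃≡1
      (subst (λ q₁ → Minimizer a (2 * q₁ ∸ 1) (+ 2) 1) (sym q₁≡1) (strictMinimizer⇒minimizer bottom-strictMinimizer))
      double-first-below minimal above

mainTheorem12 : (a : ℕ → ℕ) → PartialQuotients a → (n : ℕ) → 1 ≤ n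
    → a n ≡ 1 → a (suc n) ≡ 1 → a (suc (suc n)) ≡ 1
    → Successive a (2 * q a n) (2 * q a (suc n))
mainTheorem12 a pq zero          ()
mainTheorem12 a pq (suc zero)    _ a₁≡1 a₂≡1 a₃≡1 =
  FirstPair.successive-doubles-first a pq a₁≡1 a₂≡1 a₃≡1
mainTheorem12 a pq (suc (suc i)) _ aₙ≡1 aₙ₊₁≡1 aₙ₊₂≡1 =
  Minimizers.successive-doubles-later a pq i aₙ≡1 aₙ₊₁≡1 aₙ₊₂≡1
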